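{- For every rider $i$ and every $S\subseteq\mathcal{D}$, $\overline{F}^{\mathrm{MNL}}_i(S)\le\overline{F}_i(S)\le2\,\overline{F}^{\mathrm{MNL}}_i(S)$.
   Context: Riders $\mathcal{R}$, drivers $\mathcal{D}$; pair $(i,j)$ has weight $w_{ij}\ge0$ and acceptance probability $p_{ij}\in[0,1]$; $X_{ij}\sim\mathrm{Bern}(p_{ij})$ independent over $j$. FA valuation: $F_i(S)=\sum_{j\in S}w_{ij}\,\mathbb{E}\big[\mathbf{1}\{\sum_{k\in S}X_{ik}\ge1\}X_{ij}/\sum_{k\in S}X_{ik}\big]$. MNL surrogate: $F^{\mathrm{MNL}}_i(S)=\sum_{j\in S}\frac{w_{ij}p_{ij}}{1+\sum_{k\in S}p_{ik}}$. Downward closures: $\overline{F}_i(S)=\max_{S'\subseteq S}F_i(S')$ and $\overline{F}^{\mathrm{MNL}}_i(S)=\max_{S'\subseteq S}F^{\mathrm{MNL}}_i(S')$.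
   Formalization: The weights $w_{ij}$ and acceptance probabilities $p_{ij}$ are rational rather than real. -}

module Defs where

open import Data.Nat using (ℕ; zero; suc)
open import Data.Bool using (Bool; true; false; if_then_else_)
open import Data.Fin using (Fin)
open import Data.Fin.Subset using (Subset; _∩_; ∣_∣; ⊥; ⊤)
open import Data.Vec using (Vec; []; _∷_; lookup; map)
open import Data.List using (List; []; _∷_; _++_; foldr)
import Data.List as L
open import Data.Integer using (+_)
open import Data.Rational using (ℚ; 0ℚ; 1ℚ; _+_; _*_; _-_; _/_; _⊔_; 1/_; ≢-nonZero)
open import Data.Rational.Properties using (_≟_)
open import Relation.Nullary using (yes; no)

-- Drivers are Fin n; a set of drivers S ⊆ 𝒟 is a Subset n (Vec Bool n).
-- A realisation of the acceptance variables (X_{i1},…,X_{in}) is also a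
-- Vec Bool n (true = accepts).

sumFin : (n : ℕ) → (Fin n → ℚ) → ℚ
sumFin zero    f = 0ℚ
sumFin (suc n) f = f Fin.zero + sumFin n (λ j → f (Fin.suc j))

prodFin : (n : ℕ) → (Fin n → ℚ) → ℚ
prodFin zero    f = 1ℚ
prodFin (suc n) f = f Fin.zero * prodFin n (λ j → f (Fin.suc j))

sumOver : {n : ℕ} → Subset n → (Fin n → ℚ) → ℚ
sumOver {n} S f = sumFin n (λ j → if lookup S j then f j else 0ℚ)

subsetsOf : {n : ℕ} → Subset n → List (Subset n)
subsetsOf []            = [] ∷ []
subsetsOf (false ∷ S) = L.map (false ∷_) (subsetsOf S)
subsetsOf (true  ∷ S) = L.map (false ∷_) (subsetsOf S) ++ L.map (true ∷_) (subsetsOf S)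

outcomes : (n : ℕ) → List (Subset n)
outcomes n = subsetsOf ⊤

sumList : {A : Set} → List A → (A → ℚ) → ℚ
sumList xs f = foldr (λ x acc → f x + acc) 0ℚ xs

-- total reciprocal (1/q for q ≠ 0, and 0 at 0; only used at q > 0)
inv : ℚ → ℚ
inv q with q ≟ 0ℚ
... | yes _ = 0ℚ
... | no q≢0 = 1/_ q {{≢-nonZero q≢0}}

prob : {n : ℕ} → (Fin n → ℚ) → Subset n → ℚ
prob {n} p x = prodFin n (λ k → if lookup x k then p k else 1ℚ - p k)

share : {n : ℕ} → Subset n → Subset n → Fin n → ℚ
share S x j with ∣ S ∩ x ∣
... | zero  = 0ℚ
... | suc c = if lookup x j then + 1 / suc c else 0ℚ

F : {n : ℕ} → (w p : Fin n → ℚ) → Subset n → ℚ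
F {n} w p S =
  sumOver S (λ j → w j * sumList (outcomes n) (λ x → prob p x * share S x j))

FMNL : {n : ℕ} → (w p : Fin n → ℚ) → Subset n → ℚ
FMNL w p S = sumOver S (λ j → w j * p j * inv (1ℚ + sumOver S p))

-- downward closure: max over S' ⊆ S of G(S')  (∅ ⊆ S always, so start there)
closure : {n : ℕ} → (Subset n → ℚ) → Subset n → ℚ
closure G S = foldr (λ T acc → G T ⊔ acc) (G ⊥) (subsetsOf S)

-- Fix a set T and a driver j ∈ T, let N count the acceptances in T ∖ {j} and put μ = Σ_{k∈T} p_k.
-- As X_j is independent of N, the j-th summand of F(T) is w_j p_j 𝔼[1/(1+N)], whereas that of
-- F^MNL(T) is w_j p_j/(1+μ). Since 1/y lies above its tangents, 𝔼[1/(1+N)] ≥ 1/(1+𝔼N) ≥ 1/(1+μ).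
-- Conversely, with ν = 𝔼N, removing k from the count only increases 1/(1+N), so
--   ν 𝔼[1/(1+N)] ≤ Σ_k p_k 𝔼[1/(1+N−X_k)] = 𝔼[Σ_k X_k/N] = ℙ(N ≥ 1);
-- together with 2/(1+N) + [N ≥ 1] ≤ 2 this gives (2+ν) 𝔼[1/(1+N)] ≤ 2, hence 𝔼[1/(1+N)] ≤ 2/(1+μ)
-- as p_j ≤ 1. So F^MNL ≤ F ≤ 2 F^MNL on every set, and both inequalities survive taking maxima
-- over subsets.

module Submission where

open import Defs
open import Data.Nat using (ℕ)
open import Data.Nat using (zero; suc)
open import Data.Fin using (Fin)
open import Data.Fin.Subset using (Subset)
open import Data.Product using (_×_)
open import Data.Rational using (ℚ; 0ℚ; 1ℚ; _≤_; _*_; _+_)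

open import Data.Bool using (Bool; true; false; if_then_else_; _∧_)
open import Data.Empty using (⊥-elim)
open import Data.Fin using (zero; suc)
open import Data.Fin.Subset using (_∩_; ∣_∣; ⊥)
import Data.Integer as ℤ
import Data.Integer.Properties as ℤ
open import Data.List using (List; []; _∷_; _++_; foldr)
import Data.List as List
import Data.Nat.Coprimality as Coprimality
open Coprimality using (Coprime; 1-coprimeTo)
open import Data.Product using (_,_; proj₁; proj₂)
open import Data.Rational using (-_; _-_; _⊔_; mkℚ; _/_; 1/_; _<_; ≢-nonZero; nonNegative; nonPositive; positive)
open import Data.Rational.Properties
open import Data.Rational.Solver using (module +-*-Solver)
open import Data.Sum using (inj₁; inj₂)
open import Data.Vec using ([]; _∷_; lookup; _[_]≔_)
open import Data.Vec.Functional using (head; tail)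
open import Data.Vec.Properties using (lookup∘updateAt)
open import Function using (id)
open import Relation.Binary.PropositionalEquality
open import Relation.Nullary using (yes; no)

open +-*-Solver using (solve; _:+_; _:*_; _:-_; _:=_; con)

p≤p+q : ∀ p {q} → 0ℚ ≤ q → p ≤ p + q
p≤p+q p 0≤q = ≤-trans (≤-reflexive (sym (+-identityʳ p))) (+-monoʳ-≤ p 0≤q)

*-monoˡ-≤-0≤ : ∀ {r p q} → 0ℚ ≤ r → p ≤ q → r * p ≤ r * q
*-monoˡ-≤-0≤ {r} 0≤r = *-monoˡ-≤-nonNeg r {{nonNegative 0≤r}}

*-monoʳ-≤-0≤ : ∀ {r p q} → 0ℚ ≤ r → p ≤ q → p * r ≤ q * r
*-monoʳ-≤-0≤ {r} 0≤r = *-monoʳ-≤-nonNeg r {{nonNegative 0≤r}}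

0≤* : ∀ {p q} → 0ℚ ≤ p → 0ℚ ≤ q → 0ℚ ≤ p * q
0≤* {p} 0≤p 0≤q = ≤-trans (≤-reflexive (sym (*-zeroʳ p))) (*-monoˡ-≤-0≤ 0≤p 0≤q)

0≤+ : ∀ {p q} → 0ℚ ≤ p → 0ℚ ≤ q → 0ℚ ≤ p + q
0≤+ {p} 0≤p 0≤q = ≤-trans 0≤p (p≤p+q p 0≤q)

0≤p*p : ∀ p → 0ℚ ≤ p * p
0≤p*p p with ≤-total 0ℚ p
... | inj₁ 0≤p = 0≤* 0≤p 0≤p
... | inj₂ p≤0 = nonNegative⁻¹ (p * p) {{nonPos*nonPos⇒nonPos p {{nonPositive p≤0}} p {{nonPositive p≤0}}}}

0≤1-p : ∀ {p} → p ≤ 1ℚ → 0ℚ ≤ 1ℚ - p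
0≤1-p {p} p≤1 = ≤-trans (≤-reflexive (sym (+-inverseʳ p))) (+-monoˡ-≤ (- p) p≤1)

0≤2 : 0ℚ ≤ 1ℚ + 1ℚ
0≤2 = 0≤+ (nonNegative⁻¹ 1ℚ) (nonNegative⁻¹ 1ℚ)

inv-inverse : ∀ {q} → 0ℚ < q → q * inv q ≡ 1ℚ
inv-inverse {q} 0<q with q ≟ 0ℚ
... | yes q≡0 = ⊥-elim (<-irrefl (sym q≡0) 0<q)
... | no q≢0 = *-inverseʳ q {{≢-nonZero q≢0}}

inv-nonNeg : ∀ {q} → 0ℚ < q → 0ℚ ≤ inv q
inv-nonNeg {q} 0<q with q ≟ 0ℚ
... | yes _ = ≤-refl
... | no q≢0 = nonNegative⁻¹ _ {{pos⇒nonNeg ((1/ q) {{≢-nonZero q≢0}}) {{1/pos⇒pos q {{positive 0<q}}}}}}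

Probabilities : ∀ {n} → (Fin n → ℚ) → Set
Probabilities p = ∀ k → 0ℚ ≤ p k × p k ≤ 1ℚ

mix : ℚ → ℚ → ℚ → ℚ
mix a u v = (1ℚ - a) * u + a * v

mix-const : ∀ a c → mix a c c ≡ c
mix-const = solve 2 (λ a c → (con 1ℚ :- a) :* c :+ a :* c := c) refl

mix-+ : ∀ a u v u′ v′ → mix a (u + u′) (v + v′) ≡ mix a u v + mix a u′ v′
mix-+ = solve 5 (λ a u v u′ v′ → (con 1ℚ :- a) :* (u :+ u′) :+ a :* (v :+ v′)
                              := ((con 1ℚ :- a) :* u :+ a :* v) :+ ((con 1ℚ :- a) :* u′ :+ a :* v′)) refl

mix-*ˡ : ∀ a c u v → mix a (c * u) (c * v) ≡ c * mix a u v
mix-*ˡ = solve 4 (λ a c u v → (con 1ℚ :- a) :* (c :* u) :+ a :* (c :* v)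
                           := c :* ((con 1ℚ :- a) :* u :+ a :* v)) refl

mix-mono : ∀ {a u u′ v v′} → 0ℚ ≤ a → a ≤ 1ℚ → u ≤ u′ → v ≤ v′ → mix a u v ≤ mix a u′ v′
mix-mono 0≤a a≤1 u≤u′ v≤v′ = +-mono-≤ (*-monoˡ-≤-0≤ (0≤1-p a≤1) u≤u′) (*-monoˡ-≤-0≤ 0≤a v≤v′)

-- Expectation of f(X) for independent X_k ~ Bern(p k), computed by conditioning on X_0.
𝔼 : ∀ {n} → (Fin n → ℚ) → (Subset n → ℚ) → ℚ
𝔼 {zero}  p f = f []
𝔼 {suc n} p f = mix (head p) (𝔼 (tail p) (λ x → f (false ∷ x))) (𝔼 (tail p) (λ x → f (true ∷ x)))

sumList-++ : ∀ {A : Set} (xs ys : List A) (f : A → ℚ) → sumList (xs ++ ys) f ≡ sumList xs f + sumList ys f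
sumList-++ []       ys f = sym (+-identityˡ _)
sumList-++ (x ∷ xs) ys f = trans (cong (f x +_) (sumList-++ xs ys f)) (sym (+-assoc (f x) _ _))

sumList-prob-∷ : ∀ {n} (p : Fin (suc n) → ℚ) (f : Subset (suc n) → ℚ) b (xs : List (Subset n)) →
  sumList (List.map (b ∷_) xs) (λ x → prob p x * f x)
    ≡ (if b then head p else 1ℚ - head p) * sumList xs (λ x → prob (tail p) x * f (b ∷ x))
sumList-prob-∷ p f b []       = sym (*-zeroʳ (if b then head p else 1ℚ - head p))
sumList-prob-∷ p f b (x ∷ xs) =
  trans (cong (c * prob (tail p) x * f (b ∷ x) +_) (sumList-prob-∷ p f b xs))
        (distrib c (prob (tail p) x) (f (b ∷ x)) _)
  where
  c = if b then head p else 1ℚ - head p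
  distrib : ∀ c q y s → c * q * y + c * s ≡ c * (q * y + s)
  distrib = solve 4 (λ c q y s → c :* q :* y :+ c :* s := c :* (q :* y :+ s)) refl

sumList-outcomes : ∀ {n} (p : Fin n → ℚ) (f : Subset n → ℚ) →
  sumList (outcomes n) (λ x → prob p x * f x) ≡ 𝔼 p f
sumList-outcomes {zero}  p f = trans (+-identityʳ _) (*-identityˡ _)
sumList-outcomes {suc n} p f = begin
  sumList (List.map (false ∷_) os ++ List.map (true ∷_) os) (λ x → prob p x * f x)
    ≡⟨ sumList-++ (List.map (false ∷_) os) (List.map (true ∷_) os) (λ x → prob p x * f x) ⟩
  sumList (List.map (false ∷_) os) (λ x → prob p x * f x) + sumList (List.map (true ∷_) os) (λ x → prob p x * f x)
    ≡⟨ cong₂ _+_ (sumList-prob-∷ p f false os) (sumList-prob-∷ p f true os) ⟩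
  (1ℚ - head p) * sumList os (λ x → prob (tail p) x * f (false ∷ x)) + head p * sumList os (λ x → prob (tail p) x * f (true ∷ x))
    ≡⟨ cong₂ (mix (head p)) (sumList-outcomes (tail p) _) (sumList-outcomes (tail p) _) ⟩
  𝔼 p f ∎
  where
  open ≡-Reasoning
  os = outcomes n

𝔼-cong : ∀ {n} (p : Fin n → ℚ) {f g : Subset n → ℚ} → (∀ x → f x ≡ g x) → 𝔼 p f ≡ 𝔼 p g
𝔼-cong {zero}  p f≡g = f≡g []
𝔼-cong {suc n} p f≡g = cong₂ (mix (head p)) (𝔼-cong (tail p) (λ x → f≡g (false ∷ x)))
                                            (𝔼-cong (tail p) (λ x → f≡g (true ∷ x)))

𝔼-const : ∀ {n} (p : Fin n → ℚ) c → 𝔼 p (λ _ → c) ≡ c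
𝔼-const {zero}  p c = refl
𝔼-const {suc n} p c = trans (cong₂ (mix (head p)) (𝔼-const (tail p) c) (𝔼-const (tail p) c)) (mix-const (head p) c)

𝔼-+ : ∀ {n} (p : Fin n → ℚ) (f g : Subset n → ℚ) → 𝔼 p (λ x → f x + g x) ≡ 𝔼 p f + 𝔼 p g
𝔼-+ {zero}  p f g = refl
𝔼-+ {suc n} p f g = trans (cong₂ (mix (head p)) (𝔼-+ (tail p) _ _) (𝔼-+ (tail p) _ _)) (mix-+ (head p) _ _ _ _)

𝔼-*ˡ : ∀ {n} (p : Fin n → ℚ) c (f : Subset n → ℚ) → 𝔼 p (λ x → c * f x) ≡ c * 𝔼 p f
𝔼-*ˡ {zero}  p c f = refl
𝔼-*ˡ {suc n} p c f = trans (cong₂ (mix (head p)) (𝔼-*ˡ (tail p) c _) (𝔼-*ˡ (tail p) c _)) (mix-*ˡ (head p) c _ _)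

𝔼-mono : ∀ {n} {p : Fin n → ℚ} → Probabilities p → {f g : Subset n → ℚ} → (∀ x → f x ≤ g x) → 𝔼 p f ≤ 𝔼 p g
𝔼-mono {zero}  hp f≤g = f≤g []
𝔼-mono {suc n} hp f≤g = mix-mono (proj₁ (hp zero)) (proj₂ (hp zero))
  (𝔼-mono (λ k → hp (suc k)) (λ x → f≤g (false ∷ x)))
  (𝔼-mono (λ k → hp (suc k)) (λ x → f≤g (true ∷ x)))

X : ∀ {n} → Fin n → Subset n → ℚ
X k x = if lookup x k then 1ℚ else 0ℚ

𝔼-X*independent : ∀ {n} (p : Fin n → ℚ) (k : Fin n) (g : Subset n → ℚ) → (∀ x → g x ≡ g (x [ k ]≔ false)) →
  𝔼 p (λ x → X k x * g x) ≡ p k * 𝔼 p g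
𝔼-X*independent {suc n} p zero g g-indep = begin
  mix a (𝔼 (tail p) (λ x → 0ℚ * g (false ∷ x))) (𝔼 (tail p) (λ x → 1ℚ * g (true ∷ x)))
    ≡⟨ cong₂ (mix a) (trans (𝔼-cong (tail p) (λ x → *-zeroˡ (g (false ∷ x)))) (𝔼-const (tail p) 0ℚ))
                     (𝔼-cong (tail p) (λ x → trans (*-identityˡ (g (true ∷ x))) (g-indep (true ∷ x)))) ⟩
  mix a 0ℚ A
    ≡⟨ mix-0 a A ⟩
  a * A
    ≡⟨ cong (a *_) (sym (mix-const a A)) ⟩
  a * mix a A A
    ≡⟨ cong (λ B → a * mix a A B) (𝔼-cong (tail p) (λ x → sym (g-indep (true ∷ x)))) ⟩
  a * 𝔼 p g ∎
  where
  open ≡-Reasoning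
  a = head p
  A = 𝔼 (tail p) (λ x → g (false ∷ x))
  mix-0 : ∀ a A → mix a 0ℚ A ≡ a * A
  mix-0 = solve 2 (λ a A → (con 1ℚ :- a) :* con 0ℚ :+ a :* A := a :* A) refl
𝔼-X*independent {suc n} p (suc k) g g-indep =
  trans (cong₂ (mix (head p)) (𝔼-X*independent (tail p) k _ (λ x → g-indep (false ∷ x)))
                              (𝔼-X*independent (tail p) k _ (λ x → g-indep (true ∷ x))))
        (mix-*ˡ (head p) (p (suc k)) _ _)

𝔼-X : ∀ {n} (p : Fin n → ℚ) (k : Fin n) → 𝔼 p (X k) ≡ p k
𝔼-X p k = begin
  𝔼 p (X k)                 ≡⟨ 𝔼-cong p (λ x → sym (*-identityʳ (X k x))) ⟩
  𝔼 p (λ x → X k x * 1ℚ)    ≡⟨ 𝔼-X*independent p k (λ _ → 1ℚ) (λ _ → refl) ⟩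
  p k * 𝔼 p (λ _ → 1ℚ)      ≡⟨ cong (p k *_) (𝔼-const p 1ℚ) ⟩
  p k * 1ℚ                  ≡⟨ *-identityʳ (p k) ⟩
  p k ∎
  where open ≡-Reasoning

sumOver-cong : ∀ {n} (U : Subset n) {f g : Fin n → ℚ} → (∀ k → f k ≡ g k) → sumOver U f ≡ sumOver U g
sumOver-cong []      f≡g = refl
sumOver-cong (b ∷ U) f≡g = cong₂ _+_ (cong (if b then_else 0ℚ) (f≡g zero)) (sumOver-cong U (λ k → f≡g (suc k)))

sumOver-mono : ∀ {n} (U : Subset n) {f g : Fin n → ℚ} →
  (∀ k → lookup U k ≡ true → f k ≤ g k) → sumOver U f ≤ sumOver U g
sumOver-mono []          f≤g = ≤-refl
sumOver-mono (true ∷ U)  f≤g = +-mono-≤ (f≤g zero refl) (sumOver-mono U (λ k → f≤g (suc k)))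
sumOver-mono (false ∷ U) f≤g = +-monoʳ-≤ 0ℚ (sumOver-mono U (λ k → f≤g (suc k)))

sumOver-*ˡ : ∀ {n} (U : Subset n) c (f : Fin n → ℚ) → sumOver U (λ k → c * f k) ≡ c * sumOver U f
sumOver-*ˡ []      c f = sym (*-zeroʳ c)
sumOver-*ˡ (b ∷ U) c f =
  trans (cong₂ _+_ (if-*ˡ b) (sumOver-*ˡ U c (λ k → f (suc k)))) (sym (*-distribˡ-+ c _ _))
  where
  if-*ˡ : ∀ b → (if b then c * f zero else 0ℚ) ≡ c * (if b then f zero else 0ℚ)
  if-*ˡ true  = refl
  if-*ˡ false = sym (*-zeroʳ c)

sumOver-zero : ∀ {n} (U : Subset n) → sumOver U (λ _ → 0ℚ) ≡ 0ℚ
sumOver-zero []      = refl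
sumOver-zero (b ∷ U) = trans (cong (_+ sumOver U (λ _ → 0ℚ)) (if-zero b)) (trans (+-identityˡ _) (sumOver-zero U))
  where
  if-zero : ∀ b → (if b then 0ℚ else 0ℚ) ≡ 0ℚ
  if-zero true  = refl
  if-zero false = refl

sumOver-nonNeg : ∀ {n} (U : Subset n) {f : Fin n → ℚ} → (∀ k → 0ℚ ≤ f k) → 0ℚ ≤ sumOver U f
sumOver-nonNeg U 0≤f = ≤-trans (≤-reflexive (sym (sumOver-zero U))) (sumOver-mono U (λ k _ → 0≤f k))

sumOver-remove : ∀ {n} (T : Subset n) (j : Fin n) (f : Fin n → ℚ) → lookup T j ≡ true →
  sumOver T f ≡ f j + sumOver (T [ j ]≔ false) f
sumOver-remove (true ∷ T) zero    f refl = cong (f zero +_) (sym (+-identityˡ _))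
sumOver-remove (b ∷ T)    (suc j) f j∈T =
  trans (cong (fb +_) (sumOver-remove T j (λ k → f (suc k)) j∈T)) (swap fb (f (suc j)) _)
  where
  fb = if b then f zero else 0ℚ
  swap : ∀ a b c → a + (b + c) ≡ b + (a + c)
  swap = solve 3 (λ a b c → a :+ (b :+ c) := b :+ (a :+ c)) refl

𝔼-sumOver : ∀ {m n} (p : Fin n → ℚ) (U : Subset m) (f : Fin m → Subset n → ℚ) →
  𝔼 p (λ x → sumOver U (λ k → f k x)) ≡ sumOver U (λ k → 𝔼 p (f k))
𝔼-sumOver p []      f = 𝔼-const p 0ℚ
𝔼-sumOver p (b ∷ U) f = trans (𝔼-+ p _ _) (cong₂ _+_ (𝔼-if b) (𝔼-sumOver p U (λ k → f (suc k))))
  where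
  𝔼-if : ∀ b → 𝔼 p (λ x → if b then f zero x else 0ℚ) ≡ (if b then 𝔼 p (f zero) else 0ℚ)
  𝔼-if true  = refl
  𝔼-if false = 𝔼-const p 0ℚ

count : ∀ {n} → Subset n → Subset n → ℕ
count U x = ∣ U ∩ x ∣

fromℕ : ℕ → ℚ
fromℕ zero    = 0ℚ
fromℕ (suc m) = 1ℚ + fromℕ m

sumOver-X : ∀ {n} (U x : Subset n) → sumOver U (λ k → X k x) ≡ fromℕ (count U x)
sumOver-X []          []          = refl
sumOver-X (true ∷ U)  (true ∷ x)  = cong (1ℚ +_) (sumOver-X U x)
sumOver-X (true ∷ U)  (false ∷ x) = trans (+-identityˡ _) (sumOver-X U x)
sumOver-X (false ∷ U) (_ ∷ x)     = trans (+-identityˡ _) (sumOver-X U x)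

𝔼-count : ∀ {n} (p : Fin n → ℚ) (U : Subset n) → 𝔼 p (λ x → fromℕ (count U x)) ≡ sumOver U p
𝔼-count p U = begin
  𝔼 p (λ x → fromℕ (count U x))       ≡⟨ 𝔼-cong p (λ x → sym (sumOver-X U x)) ⟩
  𝔼 p (λ x → sumOver U (λ k → X k x)) ≡⟨ 𝔼-sumOver p U X ⟩
  sumOver U (λ k → 𝔼 p (X k))         ≡⟨ sumOver-cong U (𝔼-X p) ⟩
  sumOver U p ∎
  where open ≡-Reasoning

sucIf : Bool → ℕ → ℕ
sucIf true  = suc
sucIf false = id

count-remove : ∀ {n} (T x : Subset n) (j : Fin n) → lookup T j ≡ true →
  count T x ≡ sucIf (lookup x j) (count (T [ j ]≔ false) x)
count-remove (true ∷ T) (true ∷ x)  zero    refl = refl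
count-remove (true ∷ T) (false ∷ x) zero    refl = refl
count-remove (t ∷ T)    (b ∷ x)     (suc j) j∈T with t ∧ b
... | true  = trans (cong suc (count-remove T x j j∈T)) (suc-sucIf (lookup x j))
  where
  suc-sucIf : ∀ b {m} → suc (sucIf b m) ≡ sucIf b (suc m)
  suc-sucIf true  = refl
  suc-sucIf false = refl
... | false = count-remove T x j j∈T

count-[]≔-∉ : ∀ {n} (U x : Subset n) (k : Fin n) → lookup U k ≡ false → count U (x [ k ]≔ false) ≡ count U x
count-[]≔-∉ (false ∷ U) (b ∷ x) zero    refl = refl
count-[]≔-∉ (u ∷ U)     (b ∷ x) (suc k) k∉U with u ∧ b
... | true  = cong suc (count-[]≔-∉ U x k k∉U)
... | false = count-[]≔-∉ U x k k∉U

1/suc : ℕ → ℚ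
1/suc m = ℤ.+ 1 / suc m

1/suc-inverse : ∀ m → 1/suc m * (1ℚ + fromℕ m) ≡ 1ℚ
1/suc-inverse m = trans (cong₂ _*_ (normalize-coprime (1-coprimeTo (suc m))) (fromℕ-mkℚ (suc m)))
                        (*-inverseˡ (mkℚ (ℤ.+ suc m) 0 (coprime-1 (suc m))))
  where
  coprime-1 : ∀ m → Coprime m 1
  coprime-1 m = Coprimality.sym (1-coprimeTo m)
  fromℕ-mkℚ : ∀ m → fromℕ m ≡ mkℚ (ℤ.+ m) 0 (coprime-1 m)
  fromℕ-mkℚ zero    = refl
  fromℕ-mkℚ (suc m) = trans (cong (1ℚ +_) (fromℕ-mkℚ m))
    (trans (/-cong (cong (ℤ._+_ (ℤ.+ 1)) (ℤ.*-identityʳ (ℤ.+ m))) refl) (normalize-coprime (coprime-1 (suc m))))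

1/suc-nonNeg : ∀ m → 0ℚ ≤ 1/suc m
1/suc-nonNeg m = nonNegative⁻¹ (1/suc m) {{normalize-nonNeg 1 (suc m)}}

1/suc-antitone : ∀ m → 1/suc (suc m) ≤ 1/suc m
1/suc-antitone m = begin
  s                              ≡⟨ sym (*-identityʳ s) ⟩
  s * 1ℚ                         ≡⟨ cong (s *_) (sym (1/suc-inverse m)) ⟩
  s * (t * (1ℚ + y))             ≤⟨ p≤p+q (s * (t * (1ℚ + y))) (0≤* (1/suc-nonNeg (suc m)) (1/suc-nonNeg m)) ⟩
  s * (t * (1ℚ + y)) + s * t     ≡⟨ regroup s t y ⟩
  t * (s * (1ℚ + (1ℚ + y)))      ≡⟨ cong (t *_) (1/suc-inverse (suc m)) ⟩
  t * 1ℚ                         ≡⟨ *-identityʳ t ⟩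
  t ∎
  where
  open ≤-Reasoning
  s = 1/suc (suc m)
  t = 1/suc m
  y = fromℕ m
  regroup : ∀ s t y → s * (t * (1ℚ + y)) + s * t ≡ t * (s * (1ℚ + (1ℚ + y)))
  regroup = solve 3 (λ s t y → s :* (t :* (con 1ℚ :+ y)) :+ s :* t := t :* (s :* (con 1ℚ :+ (con 1ℚ :+ y)))) refl

1/suc-sucIf : ∀ b m → 1/suc (sucIf b m) ≤ 1/suc m
1/suc-sucIf true  m = 1/suc-antitone m
1/suc-sucIf false m = ≤-refl

-- The tangent to y ↦ 1/y at y = 1/a lies below the graph.
tangent≤reciprocal : ∀ a {s y} → 0ℚ ≤ s → s * y ≡ 1ℚ → (a + a) - a * a * y ≤ s
tangent≤reciprocal a {s} {y} 0≤s sy≡1 = begin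
  L                                    ≤⟨ p≤p+q L (0≤* 0≤s (0≤p*p (1ℚ - a * y))) ⟩
  L + s * ((1ℚ - a * y) * (1ℚ - a * y)) ≡⟨ expand a s y ⟩
  s + (a + a - a * a * y) * (1ℚ - s * y) ≡⟨ cong (λ t → s + (a + a - a * a * y) * (1ℚ - t)) sy≡1 ⟩
  s + (a + a - a * a * y) * (1ℚ - 1ℚ)   ≡⟨ cancel s (a + a - a * a * y) ⟩
  s ∎
  where
  open ≤-Reasoning
  L = (a + a) - a * a * y
  expand : ∀ a s y → (a + a) - a * a * y + s * ((1ℚ - a * y) * (1ℚ - a * y))
                   ≡ s + (a + a - a * a * y) * (1ℚ - s * y)
  expand = solve 3 (λ a s y → (a :+ a) :- a :* a :* y :+ s :* ((con 1ℚ :- a :* y) :* (con 1ℚ :- a :* y))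
                           := s :+ (a :+ a :- a :* a :* y) :* (con 1ℚ :- s :* y)) refl
  cancel : ∀ s c → s + c * (1ℚ - 1ℚ) ≡ s
  cancel = solve 2 (λ s c → s :+ c :* (con 1ℚ :- con 1ℚ) := s) refl

atLeastOne : ℕ → ℚ
atLeastOne zero    = 0ℚ
atLeastOne (suc _) = 1ℚ

twice-1/suc+atLeastOne≤2 : ∀ m → (1ℚ + 1ℚ) * 1/suc m + atLeastOne m ≤ 1ℚ + 1ℚ
twice-1/suc+atLeastOne≤2 zero    = ≤-refl
twice-1/suc+atLeastOne≤2 (suc m) = begin
  (1ℚ + 1ℚ) * s + 1ℚ             ≤⟨ p≤p+q ((1ℚ + 1ℚ) * s + 1ℚ) (0≤* (1/suc-nonNeg (suc m)) (fromℕ-nonNeg m)) ⟩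
  (1ℚ + 1ℚ) * s + 1ℚ + s * y     ≡⟨ regroup s y ⟩
  1ℚ + s * (1ℚ + (1ℚ + y))       ≡⟨ cong (1ℚ +_) (1/suc-inverse (suc m)) ⟩
  1ℚ + 1ℚ ∎
  where
  open ≤-Reasoning
  s = 1/suc (suc m)
  y = fromℕ m
  fromℕ-nonNeg : ∀ m → 0ℚ ≤ fromℕ m
  fromℕ-nonNeg zero    = ≤-refl
  fromℕ-nonNeg (suc m) = 0≤+ (nonNegative⁻¹ 1ℚ) (fromℕ-nonNeg m)
  regroup : ∀ s y → (1ℚ + 1ℚ) * s + 1ℚ + s * y ≡ 1ℚ + s * (1ℚ + (1ℚ + y))
  regroup = solve 2 (λ s y → (con 1ℚ :+ con 1ℚ) :* s :+ con 1ℚ :+ s :* y := con 1ℚ :+ s :* (con 1ℚ :+ (con 1ℚ :+ y))) refl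

share-accepted : ∀ {n} (S x : Subset n) j {c} → lookup x j ≡ true → count S x ≡ suc c → share S x j ≡ 1/suc c
share-accepted S x j x-j e rewrite e | x-j = refl

share-rejected : ∀ {n} (S x : Subset n) j → lookup x j ≡ false → share S x j ≡ 0ℚ
share-rejected S x j x-j with count S x
... | zero  = refl
... | suc c rewrite x-j = refl

share-remove : ∀ {n} (T x : Subset n) (j : Fin n) → lookup T j ≡ true →
  share T x j ≡ X j x * 1/suc (count (T [ j ]≔ false) x)
share-remove T x j j∈T with lookup x j in x-j
... | true  = trans (share-accepted T x j x-j (trans (count-remove T x j j∈T) (cong (λ b → sucIf b c) x-j)))
                    (sym (*-identityˡ (1/suc c)))
  where c = count (T [ j ]≔ false) x
... | false = trans (share-rejected T x j x-j) (sym (*-zeroˡ (1/suc (count (T [ j ]≔ false) x))))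

sumOver-share : ∀ {n} (U x : Subset n) → sumOver U (share U x) ≡ atLeastOne (count U x)
sumOver-share U x with count U x in e
... | zero  = sumOver-zero U
... | suc c = begin
  sumOver U (λ k → if lookup x k then 1/suc c else 0ℚ)  ≡⟨ sumOver-cong U (λ k → share-as-X (lookup x k)) ⟩
  sumOver U (λ k → 1/suc c * X k x)                     ≡⟨ sumOver-*ˡ U (1/suc c) (λ k → X k x) ⟩
  1/suc c * sumOver U (λ k → X k x)                     ≡⟨ cong (1/suc c *_) (trans (sumOver-X U x) (cong fromℕ e)) ⟩
  1/suc c * (1ℚ + fromℕ c)                              ≡⟨ 1/suc-inverse c ⟩
  1ℚ ∎
  where
  open ≡-Reasoning
  share-as-X : ∀ b → (if b then 1/suc c else 0ℚ) ≡ 1/suc c * (if b then 1ℚ else 0ℚ)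
  share-as-X true  = sym (*-identityʳ (1/suc c))
  share-as-X false = sym (*-zeroʳ (1/suc c))

𝔼-affine : ∀ {n} (p : Fin n → ℚ) c d (f : Subset n → ℚ) → 𝔼 p (λ x → c - d * f x) ≡ c - d * 𝔼 p f
𝔼-affine p c d f = begin
  𝔼 p (λ x → c - d * f x)            ≡⟨ 𝔼-+ p (λ _ → c) (λ x → - (d * f x)) ⟩
  𝔼 p (λ _ → c) + 𝔼 p (λ x → - (d * f x))
    ≡⟨ cong₂ _+_ (𝔼-const p c) (𝔼-cong p (λ x → neg-distribˡ-* d (f x))) ⟩
  c + 𝔼 p (λ x → - d * f x)          ≡⟨ cong (c +_) (𝔼-*ˡ p (- d) f) ⟩
  c + - d * 𝔼 p f                    ≡⟨ cong (c +_) (sym (neg-distribˡ-* d (𝔼 p f))) ⟩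
  c - d * 𝔼 p f ∎
  where open ≡-Reasoning

𝔼-share : ∀ {n} (p : Fin n → ℚ) (T : Subset n) (j : Fin n) → lookup T j ≡ true →
  𝔼 p (λ x → share T x j) ≡ p j * 𝔼 p (λ x → 1/suc (count (T [ j ]≔ false) x))
𝔼-share p T j j∈T = trans (𝔼-cong p (λ x → share-remove T x j j∈T))
  (𝔼-X*independent p j (λ x → 1/suc (count U x))
    (λ x → cong 1/suc (sym (count-[]≔-∉ U x j (lookup∘updateAt j T)))))
  where U = T [ j ]≔ false

𝔼-1/suc-count-lower : ∀ {n} {p : Fin n → ℚ} → Probabilities p → (U : Subset n) (a : ℚ) →
  (a + a) - a * a * (1ℚ + sumOver U p) ≤ 𝔼 p (λ x → 1/suc (count U x))
𝔼-1/suc-count-lower {p = p} hp U a = begin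
  (a + a) - a * a * (1ℚ + sumOver U p)
    ≡⟨ cong (λ t → (a + a) - a * a * t) (sym 𝔼-1+count) ⟩
  (a + a) - a * a * 𝔼 p (λ x → 1ℚ + fromℕ (count U x))
    ≡⟨ sym (𝔼-affine p (a + a) (a * a) _) ⟩
  𝔼 p (λ x → (a + a) - a * a * (1ℚ + fromℕ (count U x)))
    ≤⟨ 𝔼-mono hp (λ x → tangent≤reciprocal a (1/suc-nonNeg (count U x)) (1/suc-inverse (count U x))) ⟩
  𝔼 p (λ x → 1/suc (count U x)) ∎
  where
  open ≤-Reasoning
  𝔼-1+count : 𝔼 p (λ x → 1ℚ + fromℕ (count U x)) ≡ 1ℚ + sumOver U p
  𝔼-1+count = trans (𝔼-+ p (λ _ → 1ℚ) _) (cong₂ _+_ (𝔼-const p 1ℚ) (𝔼-count p U))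

𝔼-1/suc-count-upper : ∀ {n} {p : Fin n → ℚ} → Probabilities p → (U : Subset n) →
  ((1ℚ + 1ℚ) + sumOver U p) * 𝔼 p (λ x → 1/suc (count U x)) ≤ 1ℚ + 1ℚ
𝔼-1/suc-count-upper {p = p} hp U = begin
  ((1ℚ + 1ℚ) + ν) * B                         ≡⟨ *-distribʳ-+ B (1ℚ + 1ℚ) ν ⟩
  (1ℚ + 1ℚ) * B + ν * B                       ≤⟨ +-monoʳ-≤ ((1ℚ + 1ℚ) * B) ν*B≤ℙ[N≥1] ⟩
  (1ℚ + 1ℚ) * B + 𝔼 p (λ x → sumOver U (share U x))
    ≡⟨ cong (_+ 𝔼 p (λ x → sumOver U (share U x))) (sym (𝔼-*ˡ p (1ℚ + 1ℚ) _)) ⟩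
  𝔼 p (λ x → (1ℚ + 1ℚ) * 1/suc (count U x)) + 𝔼 p (λ x → sumOver U (share U x))
    ≡⟨ sym (𝔼-+ p _ _) ⟩
  𝔼 p (λ x → (1ℚ + 1ℚ) * 1/suc (count U x) + sumOver U (share U x))
    ≤⟨ 𝔼-mono hp (λ x → ≤-trans (≤-reflexive (cong ((1ℚ + 1ℚ) * 1/suc (count U x) +_) (sumOver-share U x)))
                                (twice-1/suc+atLeastOne≤2 (count U x))) ⟩
  𝔼 p (λ _ → 1ℚ + 1ℚ)                         ≡⟨ 𝔼-const p (1ℚ + 1ℚ) ⟩
  1ℚ + 1ℚ ∎
  where
  open ≤-Reasoning
  ν = sumOver U p
  B = 𝔼 p (λ x → 1/suc (count U x))
  p*B≤𝔼-share : ∀ k → lookup U k ≡ true → p k * B ≤ 𝔼 p (λ x → share U x k)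
  p*B≤𝔼-share k k∈U = begin
    p k * B
      ≤⟨ *-monoˡ-≤-0≤ (proj₁ (hp k)) (𝔼-mono hp (λ x →
           ≤-trans (≤-reflexive (cong 1/suc (count-remove U x k k∈U))) (1/suc-sucIf (lookup x k) _))) ⟩
    p k * 𝔼 p (λ x → 1/suc (count (U [ k ]≔ false) x)) ≡⟨ sym (𝔼-share p U k k∈U) ⟩
    𝔼 p (λ x → share U x k) ∎
  ν*B≤ℙ[N≥1] : ν * B ≤ 𝔼 p (λ x → sumOver U (share U x))
  ν*B≤ℙ[N≥1] = begin
    ν * B                                     ≡⟨ *-comm ν B ⟩
    B * ν                                     ≡⟨ sym (sumOver-*ˡ U B p) ⟩
    sumOver U (λ k → B * p k)                 ≡⟨ sumOver-cong U (λ k → *-comm B (p k)) ⟩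
    sumOver U (λ k → p k * B)                 ≤⟨ sumOver-mono U p*B≤𝔼-share ⟩
    sumOver U (λ k → 𝔼 p (λ x → share U x k)) ≡⟨ sym (𝔼-sumOver p U (λ k x → share U x k)) ⟩
    𝔼 p (λ x → sumOver U (share U x)) ∎

module _ {n} {p : Fin n → ℚ} (hp : Probabilities p) (T : Subset n) (j : Fin n) (j∈T : lookup T j ≡ true) where
  private
    ν = sumOver (T [ j ]≔ false) p
    μ = sumOver T p
    a = inv (1ℚ + μ)
    B = 𝔼 p (λ x → 1/suc (count (T [ j ]≔ false) x))

    1+μ≡1+pj+ν : 1ℚ + μ ≡ 1ℚ + (p j + ν)
    1+μ≡1+pj+ν = cong (1ℚ +_) (sumOver-remove T j p j∈T)

    0<1+μ : 0ℚ < 1ℚ + μ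
    0<1+μ = <-≤-trans (positive⁻¹ 1ℚ) (p≤p+q 1ℚ (sumOver-nonNeg T (λ k → proj₁ (hp k))))

    [1+μ]*a≡1 : (1ℚ + μ) * a ≡ 1ℚ
    [1+μ]*a≡1 = inv-inverse 0<1+μ

    0≤a : 0ℚ ≤ a
    0≤a = inv-nonNeg 0<1+μ

  inv[1+sumOver]≤𝔼-1/suc-count-remove :
    inv (1ℚ + sumOver T p) ≤ 𝔼 p (λ x → 1/suc (count (T [ j ]≔ false) x))
  inv[1+sumOver]≤𝔼-1/suc-count-remove = begin
    a                                            ≤⟨ p≤p+q a (0≤* (0≤* 0≤a 0≤a) (proj₁ (hp j))) ⟩
    a + a * a * p j                              ≡⟨ sym (cancel (a + a * a * p j) a) ⟩
    a + a * a * p j + a * (1ℚ - 1ℚ)              ≡⟨ cong (λ t → a + a * a * p j + a * (1ℚ - t)) (sym a[1+pj+ν]≡1) ⟩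
    a + a * a * p j + a * (1ℚ - a * (1ℚ + (p j + ν))) ≡⟨ regroup a (p j) ν ⟩
    (a + a) - a * a * (1ℚ + ν)                   ≤⟨ 𝔼-1/suc-count-lower hp (T [ j ]≔ false) a ⟩
    B ∎
    where
    open ≤-Reasoning
    a[1+pj+ν]≡1 : a * (1ℚ + (p j + ν)) ≡ 1ℚ
    a[1+pj+ν]≡1 = trans (*-comm a _) (trans (cong (_* a) (sym 1+μ≡1+pj+ν)) [1+μ]*a≡1)
    cancel : ∀ x a → x + a * (1ℚ - 1ℚ) ≡ x
    cancel = solve 2 (λ x a → x :+ a :* (con 1ℚ :- con 1ℚ) := x) refl
    regroup : ∀ a pj ν → a + a * a * pj + a * (1ℚ - a * (1ℚ + (pj + ν))) ≡ (a + a) - a * a * (1ℚ + ν)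
    regroup = solve 3 (λ a pj ν → a :+ a :* a :* pj :+ a :* (con 1ℚ :- a :* (con 1ℚ :+ (pj :+ ν)))
                               := (a :+ a) :- a :* a :* (con 1ℚ :+ ν)) refl

  𝔼-1/suc-count-remove≤2*inv[1+sumOver] :
    𝔼 p (λ x → 1/suc (count (T [ j ]≔ false) x)) ≤ (1ℚ + 1ℚ) * inv (1ℚ + sumOver T p)
  𝔼-1/suc-count-remove≤2*inv[1+sumOver] = begin
    B                          ≡⟨ sym (*-identityˡ B) ⟩
    1ℚ * B                     ≡⟨ cong (_* B) (sym [1+μ]*a≡1) ⟩
    ((1ℚ + μ) * a) * B         ≡⟨ swap (1ℚ + μ) a B ⟩
    a * ((1ℚ + μ) * B)         ≤⟨ *-monoˡ-≤-0≤ 0≤a (*-monoʳ-≤-0≤ 0≤B 1+μ≤2+ν) ⟩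
    a * (((1ℚ + 1ℚ) + ν) * B)  ≤⟨ *-monoˡ-≤-0≤ 0≤a (𝔼-1/suc-count-upper hp (T [ j ]≔ false)) ⟩
    a * (1ℚ + 1ℚ)              ≡⟨ *-comm a (1ℚ + 1ℚ) ⟩
    (1ℚ + 1ℚ) * a ∎
    where
    open ≤-Reasoning
    0≤B : 0ℚ ≤ B
    0≤B = ≤-trans (≤-reflexive (sym (𝔼-const p 0ℚ))) (𝔼-mono hp (λ x → 1/suc-nonNeg (count (T [ j ]≔ false) x)))
    1+μ≤2+ν : 1ℚ + μ ≤ (1ℚ + 1ℚ) + ν
    1+μ≤2+ν = ≤-trans (≤-reflexive 1+μ≡1+pj+ν)
      (≤-trans (+-monoʳ-≤ 1ℚ (+-monoˡ-≤ ν (proj₂ (hp j)))) (≤-reflexive (sym (+-assoc 1ℚ 1ℚ ν))))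
    swap : ∀ m a b → (m * a) * b ≡ a * (m * b)
    swap = solve 3 (λ m a b → (m :* a) :* b := a :* (m :* b)) refl

FMNL≤F : ∀ {n} {w p : Fin n → ℚ} → (∀ k → 0ℚ ≤ w k) → Probabilities p → ∀ T → FMNL w p T ≤ F w p T
FMNL≤F {n} {w} {p} hw hp T = sumOver-mono T λ j j∈T → begin
  w j * p j * inv (1ℚ + sumOver T p)
    ≡⟨ *-assoc (w j) (p j) _ ⟩
  w j * (p j * inv (1ℚ + sumOver T p))
    ≤⟨ *-monoˡ-≤-0≤ (hw j) (*-monoˡ-≤-0≤ (proj₁ (hp j)) (inv[1+sumOver]≤𝔼-1/suc-count-remove hp T j j∈T)) ⟩
  w j * (p j * 𝔼 p (λ x → 1/suc (count (T [ j ]≔ false) x)))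
    ≡⟨ cong (w j *_) (sym (trans (sumList-outcomes p _) (𝔼-share p T j j∈T))) ⟩
  w j * sumList (outcomes n) (λ x → prob p x * share T x j) ∎
  where open ≤-Reasoning

F≤2*FMNL : ∀ {n} {w p : Fin n → ℚ} → (∀ k → 0ℚ ≤ w k) → Probabilities p → ∀ T → F w p T ≤ (1ℚ + 1ℚ) * FMNL w p T
F≤2*FMNL {n} {w} {p} hw hp T = ≤-trans (sumOver-mono T λ j j∈T → begin
  w j * sumList (outcomes n) (λ x → prob p x * share T x j)
    ≡⟨ cong (w j *_) (trans (sumList-outcomes p _) (𝔼-share p T j j∈T)) ⟩
  w j * (p j * 𝔼 p (λ x → 1/suc (count (T [ j ]≔ false) x)))
    ≤⟨ *-monoˡ-≤-0≤ (hw j) (*-monoˡ-≤-0≤ (proj₁ (hp j)) (𝔼-1/suc-count-remove≤2*inv[1+sumOver] hp T j j∈T)) ⟩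
  w j * (p j * ((1ℚ + 1ℚ) * inv (1ℚ + sumOver T p)))
    ≡⟨ regroup (w j) (p j) _ ⟩
  (1ℚ + 1ℚ) * (w j * p j * inv (1ℚ + sumOver T p)) ∎)
  (≤-reflexive (sumOver-*ˡ T (1ℚ + 1ℚ) _))
  where
  open ≤-Reasoning
  regroup : ∀ w p a → w * (p * ((1ℚ + 1ℚ) * a)) ≡ (1ℚ + 1ℚ) * (w * p * a)
  regroup = solve 3 (λ w p a → w :* (p :* ((con 1ℚ :+ con 1ℚ) :* a)) := (con 1ℚ :+ con 1ℚ) :* (w :* p :* a)) refl

closure-mono : ∀ {n} {G H : Subset n → ℚ} → (∀ T → G T ≤ H T) → ∀ S → closure G S ≤ closure H S
closure-mono {G = G} {H} G≤H S = go (subsetsOf S)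
  where
  go : ∀ Ts → foldr (λ T acc → G T ⊔ acc) (G ⊥) Ts ≤ foldr (λ T acc → H T ⊔ acc) (H ⊥) Ts
  go []       = G≤H ⊥
  go (T ∷ Ts) = ⊔-mono-≤ (G≤H T) (go Ts)

closure-*ˡ : ∀ {n} {c} → 0ℚ ≤ c → ∀ (G : Subset n → ℚ) S → closure (λ T → c * G T) S ≡ c * closure G S
closure-*ˡ {c = c} 0≤c G S = go (subsetsOf S)
  where
  go : ∀ Ts → foldr (λ T acc → c * G T ⊔ acc) (c * G ⊥) Ts ≡ c * foldr (λ T acc → G T ⊔ acc) (G ⊥) Ts
  go []       = refl
  go (T ∷ Ts) = trans (cong (c * G T ⊔_) (go Ts)) (sym (*-distribˡ-⊔-nonNeg c {{nonNegative 0≤c}} (G T) _))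

corollary2 : (m n : ℕ) → (w p : Fin m → Fin n → ℚ)
    → (∀ i j → 0ℚ ≤ w i j) → (∀ i j → 0ℚ ≤ p i j × p i j ≤ 1ℚ)
    → ∀ (i : Fin m) (S : Subset n)
    → closure (FMNL (w i) (p i)) S ≤ closure (F (w i) (p i)) S
      × closure (F (w i) (p i)) S ≤ (1ℚ + 1ℚ) * closure (FMNL (w i) (p i)) S
corollary2 m n w p hw hp i S =
  closure-mono (FMNL≤F (hw i) (hp i)) S ,
  ≤-trans (closure-mono (F≤2*FMNL (hw i) (hp i)) S) (≤-reflexive (closure-*ˡ 0≤2 (FMNL (w i) (p i)) S))
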